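{- Let $\mathcal{Y}$ be an $m\times n$ zero-nonzero pattern and let $G$ be a finite simple graph with a partition $(V_1,V_2)$ according to $\mathcal{Y}$. Let $k$ be the smallest size of a zero forcing set $F$ for $G$ that forces from $V_1$ to $V_2$. Then $\operatorname{tri}(\mathcal{Y}) = m+n-k$.
   Context: A zero-nonzero pattern is a matrix with entries in $\{0,*\}$; a square pattern is a triangle if some permutation of its rows followed by some independent permutation of its columns yields a lower-triangular pattern with only $*$ entries on the diagonal; $\operatorname{tri}(\mathcal{Y})$ is the largest size of a square submatrix of $\mathcal{Y}$ that is a triangle. For a graph $G$ on $m+n$ vertices, disjoint sets $V_1=\{r_1,\dots,r_m\}$, $V_2=\{c_1,\dots,c_n\}$ with $V(G)=V_1\cup V_2$ form a partition of $G$ according to $\mathcal{Y}$ if $r_i$ is adjacent to $c_j$ exactly when the $(i,j)$ entry of $\mathcal{Y}$ is $*$ (edges within $V_1$ or within $V_2$ are unrestricted). Zero forcing rule: a filled vertex $v$ forces an unfilled vertex $u$ if $u$ is the only unfilled neighbor of $v$; each vertex forces at most once. A forcing sequence from $F$ is complete if no further force is possible afterwards; $F$ is a zero forcing set if repeated forcing fills all vertices. A zero forcing set $F$ forces from $V_1$ to $V_2$ if $V_1\subseteq F$ and there is a complete forcing sequence from $F$ in which every vertex that forces is in $V_1$ and every vertex that gets forced is in $V_2$ (such $F$ always exists, e.g. $F=V(G)$). -}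

module Defs where

open import Data.Nat using (ℕ; _+_; _≤_)
open import Data.Bool using (Bool; true; false)
open import Data.Fin using (Fin; _<_; _↑ˡ_; _↑ʳ_)
open import Data.Fin.Subset using (Subset; _∈_; ∣_∣)
open import Data.Fin.Permutation using (Permutation′; _⟨$⟩ʳ_)
open import Data.List using (List; map)
open import Data.List.Relation.Unary.All using (All)
import Data.List.Membership.Propositional as LM
open import Data.Product using (Σ; ∃; _×_; proj₁; proj₂)
open import Data.Sum using (_⊎_)
open import Relation.Binary.PropositionalEquality using (_≡_)
open import Relation.Nullary using (¬_)

-- Zero-nonzero patterns: true = * (nonzero), false = 0.

Pattern : ℕ → ℕ → Set
Pattern m n = Fin m → Fin n → Bool

IsTriangle : {t : ℕ} → Pattern t t → Set
IsTriangle {t} P =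
  Σ (Permutation′ t) λ σ → Σ (Permutation′ t) λ τ →
    ((i : Fin t) → P (σ ⟨$⟩ʳ i) (τ ⟨$⟩ʳ i) ≡ true) ×
    ((i j : Fin t) → i < j → P (σ ⟨$⟩ʳ i) (τ ⟨$⟩ʳ j) ≡ false)

StrictlyIncreasing : {t m : ℕ} → (Fin t → Fin m) → Set
StrictlyIncreasing {t} f = (i j : Fin t) → i < j → f i < f j

HasTriangleOfSize : {m n : ℕ} → Pattern m n → ℕ → Set
HasTriangleOfSize {m} {n} Y t =
  Σ (Fin t → Fin m) λ r → Σ (Fin t → Fin n) λ c →
    StrictlyIncreasing r × StrictlyIncreasing c ×
    IsTriangle (λ i j → Y (r i) (c j))

IsTri : {m n : ℕ} → Pattern m n → ℕ → Set
IsTri Y t = HasTriangleOfSize Y t × (∀ s → HasTriangleOfSize Y s → s ≤ t)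

record SimpleGraph (N : ℕ) : Set where
  field
    Adj   : Fin N → Fin N → Bool
    sym   : ∀ u v → Adj u v ≡ Adj v u
    irrefl : ∀ v → Adj v v ≡ false
open SimpleGraph public

-- Vertices of G are Fin (m + n): r_i = i ↑ˡ n (V₁), c_j = m ↑ʳ j (V₂).
-- (V₁ , V₂) is a partition of G according to Y.
PartitionAccordingTo : {m n : ℕ} → Pattern m n → SimpleGraph (m + n) → Set
PartitionAccordingTo {m} {n} Y G =
  ∀ (i : Fin m) (j : Fin n) → Adj G (i ↑ˡ n) (m ↑ʳ j) ≡ Y i j

InV₁ : {m n : ℕ} → Fin (m + n) → Set
InV₁ {m} {n} v = ∃ λ (i : Fin m) → v ≡ i ↑ˡ n

InV₂ : {m n : ℕ} → Fin (m + n) → Set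
InV₂ {m} {n} v = ∃ λ (j : Fin n) → v ≡ m ↑ʳ j

-- Zero forcing. A forcing sequence is a list of forces (v , u) meaning
-- "v forces u", stored in REVERSE chronological order (latest first).

module _ {N : ℕ} (G : SimpleGraph N) where
  open LM using () renaming (_∈_ to _∈L_; _∉_ to _∉L_)

  Force : Set
  Force = Fin N × Fin N

  Filled : Subset N → List Force → Fin N → Set
  Filled F s u = u ∈ F ⊎ u ∈L map proj₂ s

  ValidForce : Subset N → List Force → Force → Set
  ValidForce F s f =
    Filled F s (proj₁ f) × ¬ Filled F s (proj₂ f) ×
    Adj G (proj₁ f) (proj₂ f) ≡ true ×
    (∀ w → Adj G (proj₁ f) w ≡ true → ¬ Filled F s w → w ≡ proj₂ f) ×
    proj₁ f ∉L map proj₁ s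

  data ForcingSeq (F : Subset N) : List Force → Set where
    []  : ForcingSeq F Data.List.[]
    _∷_ : ∀ {s} f → ValidForce F s f → ForcingSeq F s →
          ForcingSeq F (f Data.List.∷ s)

  Complete : Subset N → List Force → Set
  Complete F s = ¬ (∃ λ f → ValidForce F s f)

  IsZeroForcingSet : Subset N → Set
  IsZeroForcingSet F =
    ∃ λ s → ForcingSeq F s × (∀ u → Filled F s u)

ForcesFromV₁toV₂ : (m n : ℕ) → SimpleGraph (m + n) → Subset (m + n) → Set
ForcesFromV₁toV₂ m n G F =
  IsZeroForcingSet G F ×
  (∀ (i : Fin m) → (i ↑ˡ n) ∈ F) ×
  (∃ λ s → ForcingSeq G F s × Complete G F s ×
     All (λ f → InV₁ {m} {n} (proj₁ f) × InV₂ {m} {n} (proj₂ f)) s)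

IsMinV₁V₂ForcingSize : (m n : ℕ) → SimpleGraph (m + n) → ℕ → Set
IsMinV₁V₂ForcingSize m n G k =
  (∃ λ F → ForcesFromV₁toV₂ m n G F × ∣ F ∣ ≡ k) ×
  (∀ F → ForcesFromV₁toV₂ m n G F → k ≤ ∣ F ∣)

{-# OPTIONS --safe #-}
-- A forcing sequence from V₁ to V₂ is a list of edges rᵢcᵢ along which rᵢ forces cᵢ.
-- When rᵢ forces cᵢ, every earlier forcer already has all its neighbours filled, so it
-- is not adjacent to cᵢ: in forcing order the forces are the diagonal of a triangle
-- submatrix of Y.  Conversely, starting from all vertices except the columns of a
-- triangle, its rows force its columns along the diagonal.  Each force fills a new
-- vertex outside F, and a complete sequence from a zero forcing set fills all of them,
-- so such a sequence has exactly m + n - |F| forces.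
module Submission where

open import Defs hiding (sym)
open import Data.Bool using (Bool; true; false)
open import Data.Bool.Properties using (¬-not)
open import Data.Fin using (Fin; zero; suc; _<_; _↑ˡ_; _↑ʳ_; splitAt; punchIn; punchOut; opposite; _≟_)
open import Data.Fin.Permutation using (Permutation′; _⟨$⟩ʳ_; _∘ₚ_; reverse; insert; insert-punchIn) renaming (id to idₚ)
open import Data.Fin.Properties using (<-cmp; any?; opposite-prop; toℕ<n; punchInᵢ≢i; punchOut-injective; punchIn-punchOut; punchIn-injective; splitAt-↑ˡ; splitAt-↑ʳ)
open import Data.Fin.Subset using (Subset; _∈_; _∉_; ∣_∣; ∁; _-_; ⁅_⁆; inside; outside)
open import Data.Fin.Subset.Properties using (_∈?_; Empty-unique; ∣⊥∣≡0; p─⊥≡p; p─q⊆p; x∈p∧x≢y⇒x∈p-y; x∈p⇒∣p-x∣<∣p∣; x∈∁p⇒x∉p; x∉p⇒x∈∁p; x∉∁p⇒x∈p; x∈p⇒x∉∁p; ∣∁p∣≡n∸∣p∣)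
open import Data.List using (List; []; _∷_; map; length; lookup; tabulate)
open import Data.List.Properties using (length-map; length-tabulate; map-tabulate)
open import Data.List.Membership.Propositional using () renaming (_∈_ to _∈ₗ_; _∉_ to _∉ₗ_)
open import Data.List.Membership.Propositional.Properties using (∈-map⁺; ∈-lookup; ∈-tabulate⁺; ∈-tabulate⁻)
open import Data.List.Relation.Unary.Any using (here; there)
open import Data.List.Relation.Unary.All as All using (All; []; _∷_)
open import Data.List.Relation.Unary.All.Properties using (¬Any⇒All¬; tabulate⁺)
open import Data.List.Relation.Unary.AllPairs using ([]; _∷_)
open import Data.List.Relation.Unary.Unique.Propositional using (Unique)
open import Data.Nat as ℕ using (ℕ; _+_; _∸_; _≤_; z≤n; s≤s; z<s; s<s)
open import Data.Nat.Properties using (≤-reflexive; ≤-trans; ≤-antisym; n≤1+n; ∸-monoʳ-≤; ∸-monoʳ-<; module ≤-Reasoning)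
open import Data.Product using (Σ; ∃; _×_; _,_; proj₁; proj₂)
open import Data.Sum using (inj₁; inj₂; fromInj₂)
open import Data.Vec as Vec using (_∷_)
open import Data.Vec.Properties using (lookup∘tabulate; lookup⇒[]=; []=⇒lookup)
open import Data.Vec.Functional using () renaming (_∷_ to _◂_)
open import Function using (_∘_)
open import Relation.Binary.Definitions using (tri<; tri≈; tri>)
open import Relation.Binary.PropositionalEquality using (_≡_; _≢_; refl; sym; trans; cong; cong₂; subst; ≢-sym; module ≡-Reasoning)
open import Relation.Nullary using (¬_; Dec; yes; no; does; contradiction)
open import Relation.Nullary.Decidable using (dec-true; _⊎-dec_)

∣p∣≤1+∣p-x∣ : ∀ {N} (p : Subset N) x → ∣ p ∣ ≤ ℕ.suc ∣ p - x ∣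
∣p∣≤1+∣p-x∣ (inside  ∷ p) zero    = ≤-reflexive (cong (ℕ.suc ∘ ∣_∣) (sym (p─⊥≡p p)))
∣p∣≤1+∣p-x∣ (outside ∷ p) zero    = ≤-trans (≤-reflexive (cong ∣_∣ (sym (p─⊥≡p p)))) (n≤1+n _)
∣p∣≤1+∣p-x∣ (inside  ∷ p) (suc x) = s≤s (∣p∣≤1+∣p-x∣ p x)
∣p∣≤1+∣p-x∣ (outside ∷ p) (suc x) = ∣p∣≤1+∣p-x∣ p x

x∉p-x : ∀ {N} (p : Subset N) x → x ∉ p - x
x∉p-x (_ ∷ p) zero    ()
x∉p-x (_ ∷ p) (suc x) (Vec.there x∈p-x) = x∉p-x p x x∈p-x

∣p∣≤length : ∀ {N} (p : Subset N) xs → (∀ {x} → x ∈ p → x ∈ₗ xs) → ∣ p ∣ ≤ length xs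
∣p∣≤length {N} p [] p⊆[] =
  ≤-reflexive (trans (cong ∣_∣ (Empty-unique λ (_ , x∈p) → contradiction (p⊆[] x∈p) λ ())) (∣⊥∣≡0 N))
∣p∣≤length p (y ∷ xs) p⊆y∷xs = ≤-trans (∣p∣≤1+∣p-x∣ p y) (s≤s (∣p∣≤length (p - y) xs p-y⊆xs))
  where
  p-y⊆xs : ∀ {x} → x ∈ p - y → x ∈ₗ xs
  p-y⊆xs x∈p-y with p⊆y∷xs (p─q⊆p p ⁅ y ⁆ x∈p-y)
  ... | here refl  = contradiction x∈p-y (x∉p-x p y)
  ... | there x∈xs = x∈xs

length≤∣p∣ : ∀ {N} (p : Subset N) {xs} → Unique xs → All (_∈ p) xs → length xs ≤ ∣ p ∣
length≤∣p∣ p []              []            = z≤n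
length≤∣p∣ p (y≢xs ∷ unique) (y∈p ∷ xs⊆p) =
  ≤-trans (s≤s (length≤∣p∣ (p - _) unique xs⊆p-y)) (x∈p⇒∣p-x∣<∣p∣ y∈p)
  where
  xs⊆p-y = All.zipWith (λ (x∈p , y≢x) → x∈p∧x≢y⇒x∈p-y x∈p (≢-sym y≢x)) (xs⊆p , y≢xs)

select : ∀ {N} {P : Fin N → Set} → (∀ x → Dec (P x)) → Subset N
select P? = Vec.tabulate (does ∘ P?)

module _ {N} {P : Fin N → Set} (P? : ∀ x → Dec (P x)) where

  ∈-select⁺ : ∀ {x} → P x → x ∈ select P?
  ∈-select⁺ {x} px = lookup⇒[]= x (select P?) (trans (lookup∘tabulate _ x) (dec-true (P? x) px))

  ∈-select⁻ : ∀ {x} → x ∈ select P? → P x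
  ∈-select⁻ {x} x∈ with P? x | trans (sym (lookup∘tabulate (does ∘ P?) x)) ([]=⇒lookup x∈)
  ... | yes px | _ = px
  ... | no _   | ()

IncreasingFactorisation : ∀ {t M} → (Fin t → Fin M) → Set
IncreasingFactorisation {t} {M} a =
  Σ (Fin t → Fin M) λ r → Σ (Permutation′ t) λ σ → StrictlyIncreasing r × (∀ i → r (σ ⟨$⟩ʳ i) ≡ a i)

insert-↦ : ∀ {t} i j (π : Permutation′ t) → insert i j π ⟨$⟩ʳ i ≡ j
insert-↦ i j π with i ≟ i
... | yes _   = refl
... | no i≢i = contradiction refl i≢i

-- Recursion on M: the index sent to 0, if there is one, is put first by the permutation.
sortInjection : ∀ {t M} (a : Fin t → Fin M) → (∀ {i j} → a i ≡ a j → i ≡ j) → IncreasingFactorisation a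
sortInjection {ℕ.zero}  a _ = (λ ()) , idₚ , (λ ()) , (λ ())
sortInjection {ℕ.suc t} {ℕ.zero} a _ with a zero
... | ()
sortInjection {ℕ.suc t} {ℕ.suc M} a inj with any? (λ i → a i ≟ zero)
... | no 0∉a =
  shift (sortInjection (λ i → punchOut (avoid i)) (inj ∘ punchOut-injective (avoid _) (avoid _)))
  where
  avoid : ∀ i → zero ≢ a i
  avoid i 0≡ai = 0∉a (i , sym 0≡ai)
  shift : IncreasingFactorisation (λ i → punchOut (avoid i)) → IncreasingFactorisation a
  shift (r , σ , r↑ , r∘σ≡) =
    suc ∘ r , σ , (λ i j i<j → s<s (r↑ i j i<j)) ,
    λ i → trans (cong suc (r∘σ≡ i)) (punchIn-punchOut (avoid i))
... | yes (i₀ , ai₀≡0) = prepend (sortInjection (λ j → punchOut (avoid j)) inj′)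
  where
  avoid : ∀ j → zero ≢ a (punchIn i₀ j)
  avoid j 0≡a = punchInᵢ≢i i₀ j (inj (trans (sym 0≡a) (sym ai₀≡0)))
  inj′ : ∀ {j k} → punchOut (avoid j) ≡ punchOut (avoid k) → j ≡ k
  inj′ {j} {k} = punchIn-injective i₀ j k ∘ inj ∘ punchOut-injective (avoid j) (avoid k)
  prepend : IncreasingFactorisation (λ j → punchOut (avoid j)) → IncreasingFactorisation a
  prepend (r , σ , r↑ , r∘σ≡) = r₀ , π , r₀↑ , λ i → factorAt i (i₀ ≟ i)
    where
    open ≡-Reasoning
    r₀ = zero ◂ (suc ∘ r)
    π = insert i₀ zero σ
    r₀↑ : StrictlyIncreasing r₀
    r₀↑ zero    zero    ()
    r₀↑ zero    (suc j) _         = z<s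
    r₀↑ (suc i) (suc j) (s<s i<j) = s<s (r↑ i j i<j)
    factorAt : ∀ i → Dec (i₀ ≡ i) → r₀ (π ⟨$⟩ʳ i) ≡ a i
    factorAt _ (yes refl) = trans (cong r₀ (insert-↦ i₀ zero σ)) (sym ai₀≡0)
    factorAt i (no i₀≢i)  = begin
      r₀ (π ⟨$⟩ʳ i)             ≡⟨ cong (λ k → r₀ (π ⟨$⟩ʳ k)) (punchIn-punchOut i₀≢i) ⟨
      r₀ (π ⟨$⟩ʳ punchIn i₀ j)  ≡⟨ cong r₀ (insert-punchIn i₀ zero σ j) ⟩
      suc (r (σ ⟨$⟩ʳ j))        ≡⟨ cong suc (r∘σ≡ j) ⟩
      suc (punchOut (avoid j))  ≡⟨ punchIn-punchOut (avoid j) ⟩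
      a (punchIn i₀ j)          ≡⟨ cong a (punchIn-punchOut i₀≢i) ⟩
      a i                       ∎
      where j = punchOut i₀≢i

<-distinct⇒injective : ∀ {t} {A : Set} (f : Fin t → A) → (∀ {p q} → p < q → f p ≢ f q) →
  ∀ {p q} → f p ≡ f q → p ≡ q
<-distinct⇒injective f distinct {p} {q} fp≡fq with <-cmp p q
... | tri< p<q _ _ = contradiction fp≡fq (distinct p<q)
... | tri≈ _ p≡q _ = p≡q
... | tri> _ _ q<p = contradiction (sym fp≡fq) (distinct q<p)

record IsUpperTriangle {A B : Set} {t} (M : A → B → Bool) (a : Fin t → A) (b : Fin t → B) : Set where
  field
    diagonal       : ∀ p → M (a p) (b p) ≡ true
    below-diagonal : ∀ {p q} → p < q → M (a q) (b p) ≡ false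

  open ≡-Reasoning

  rows-distinct : ∀ {p q} → p < q → a p ≢ a q
  rows-distinct {p} {q} p<q ap≡aq = contradiction (begin
    true           ≡⟨ diagonal p ⟨
    M (a p) (b p)  ≡⟨ cong (λ x → M x (b p)) ap≡aq ⟩
    M (a q) (b p)  ≡⟨ below-diagonal p<q ⟩
    false          ∎) λ ()

  cols-distinct : ∀ {p q} → p < q → b p ≢ b q
  cols-distinct {p} {q} p<q bp≡bq = contradiction (begin
    true           ≡⟨ diagonal q ⟨
    M (a q) (b q)  ≡⟨ cong (M (a q)) bp≡bq ⟨
    M (a q) (b p)  ≡⟨ below-diagonal p<q ⟩
    false          ∎) λ ()

  rows-injective : ∀ {p q} → a p ≡ a q → p ≡ q
  rows-injective = <-distinct⇒injective a rows-distinct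

  cols-injective : ∀ {p q} → b p ≡ b q → p ≡ q
  cols-injective = <-distinct⇒injective b cols-distinct

open IsUpperTriangle

IsUpperTriangle-tail : ∀ {A B : Set} {t} {M : A → B → Bool} {a : Fin (ℕ.suc t) → A} {b : Fin (ℕ.suc t) → B} →
  IsUpperTriangle M a b → IsUpperTriangle M (a ∘ suc) (b ∘ suc)
IsUpperTriangle-tail tri = record
  { diagonal       = diagonal tri ∘ suc
  ; below-diagonal = λ p<q → below-diagonal tri (s<s p<q)
  }

IsUpperTriangle-resp : ∀ {A B A′ B′ : Set} {t} {M : A → B → Bool} {M′ : A′ → B′ → Bool}
  {a : Fin t → A} {b : Fin t → B} {a′ : Fin t → A′} {b′ : Fin t → B′} →
  (∀ p q → M (a q) (b p) ≡ M′ (a′ q) (b′ p)) →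
  IsUpperTriangle M a b → IsUpperTriangle M′ a′ b′
IsUpperTriangle-resp M≡M′ tri = record
  { diagonal       = λ p → trans (sym (M≡M′ p p)) (diagonal tri p)
  ; below-diagonal = λ {p} {q} p<q → trans (sym (M≡M′ p q)) (below-diagonal tri p<q)
  }

HasUpperTriangle : ∀ {m n} → Pattern m n → ℕ → Set
HasUpperTriangle {m} {n} Y t = Σ (Fin t → Fin m) λ a → Σ (Fin t → Fin n) λ b → IsUpperTriangle Y a b

opposite-< : ∀ {t} {p q : Fin t} → p < q → opposite q < opposite p
opposite-< {t} {p} {q} p<q rewrite opposite-prop p | opposite-prop q = ∸-monoʳ-< (s<s p<q) (toℕ<n q)

-- IsTriangle is lower triangular in forcing order, whereas forcing lists are stored
-- latest first; the conversions reverse the indices.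
triangle⇒upperTriangle : ∀ {m n t} {Y : Pattern m n} → HasTriangleOfSize Y t → HasUpperTriangle Y t
triangle⇒upperTriangle (r , c , _ , _ , σ , τ , diag , above) =
  (λ p → r (σ ⟨$⟩ʳ opposite p)) , (λ p → c (τ ⟨$⟩ʳ opposite p)) ,
  record { diagonal = diag ∘ opposite ; below-diagonal = λ p<q → above _ _ (opposite-< p<q) }

upperTriangle⇒triangle : ∀ {m n t} {Y : Pattern m n} → HasUpperTriangle Y t → HasTriangleOfSize Y t
upperTriangle⇒triangle {Y = Y} (a , b , tri)
  with sortInjection a (rows-injective tri) | sortInjection b (cols-injective tri)
... | r , σ , r↑ , r∘σ≡a | c , τ , c↑ , c∘τ≡b =
  r , c , r↑ , c↑ , reverse ∘ₚ σ , reverse ∘ₚ τ ,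
  diagonal sorted ∘ opposite , λ i j i<j → below-diagonal sorted (opposite-< i<j)
  where
  sorted : IsUpperTriangle Y (λ p → r (σ ⟨$⟩ʳ p)) (λ p → c (τ ⟨$⟩ʳ p))
  sorted = IsUpperTriangle-resp (λ p q → cong₂ Y (sym (r∘σ≡a q)) (sym (c∘τ≡b p))) tri

module ZeroForcing {N : ℕ} (G : SimpleGraph N) where
  open import Data.List.Membership.DecPropositional (_≟_ {N}) using () renaming (_∈?_ to _∈ₗ?_)

  filled? : ∀ F s u → Dec (Filled G F s u)
  filled? F s u = (u ∈? F) ⊎-dec (u ∈ₗ? map proj₂ s)

  filled-∷ : ∀ {F s} f {w} → Filled G F s w → Filled G F (f ∷ s) w
  filled-∷ f (inj₁ w∈F)  = inj₁ w∈F
  filled-∷ f (inj₂ w∈s) = inj₂ (there w∈s)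

  neighbours-filled : ∀ {F s v w} → ForcingSeq G F s → v ∈ₗ map proj₁ s → Adj G v w ≡ true → Filled G F s w
  neighbours-filled {F} {w = w} (_∷_ {s} f (_ , _ , _ , onlyUnfilled , _) _) (here refl) vw with filled? F s w
  ... | yes w-filled  = filled-∷ f w-filled
  ... | no w-unfilled = inj₂ (here (onlyUnfilled w vw w-unfilled))
  neighbours-filled (_∷_ f _ fs) (there v∈s) vw = filled-∷ f (neighbours-filled fs v∈s vw)

  -- A force (v , u) of s′ with u unfilled after s would still be available at the end of s.
  complete-maximal : ∀ {F s s′} → ForcingSeq G F s → Complete G F s → ForcingSeq G F s′ →
    ∀ {u} → Filled G F s′ u → Filled G F s u
  complete-maximal fs complete fs′ (inj₁ u∈F) = inj₁ u∈F
  complete-maximal fs complete (_∷_ f _ fs′) (inj₂ (there u∈s′)) = complete-maximal fs complete fs′ (inj₂ u∈s′)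
  complete-maximal {F} {s} fs complete
    (_∷_ (v , u) (v-filled , _ , vu , onlyUnfilled , _) fs′) (inj₂ (here refl)) with filled? F s u
  ... | yes u-filled  = u-filled
  ... | no u-unfilled = contradiction
    ((v , u) , complete-maximal fs complete fs′ v-filled , u-unfilled , vu ,
      (λ w vw w-unfilled → onlyUnfilled w vw (w-unfilled ∘ complete-maximal fs complete fs′)) ,
      (λ v-forced → u-unfilled (neighbours-filled fs v-forced vu)))
    complete

  forced-unique : ∀ {F s} → ForcingSeq G F s → Unique (map proj₂ s)
  forced-unique []                            = []
  forced-unique (_∷_ _ (_ , unfilled , _) fs) = ¬Any⇒All¬ _ (unfilled ∘ inj₂) ∷ forced-unique fs

  forced-∉ : ∀ {F s} → ForcingSeq G F s → All (_∉ F) (map proj₂ s)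
  forced-∉ []                            = []
  forced-∉ (_∷_ _ (_ , unfilled , _) fs) = unfilled ∘ inj₁ ∷ forced-∉ fs

  length≤∣∁F∣ : ∀ {F s} → ForcingSeq G F s → length s ≤ ∣ ∁ F ∣
  length≤∣∁F∣ {F} {s} fs = subst (_≤ ∣ ∁ F ∣) (length-map proj₂ s)
    (length≤∣p∣ (∁ F) (forced-unique fs) (All.map x∉p⇒x∈∁p (forced-∉ fs)))

  ∣∁F∣≤length : ∀ {F s} → IsZeroForcingSet G F → ForcingSeq G F s → Complete G F s → ∣ ∁ F ∣ ≤ length s
  ∣∁F∣≤length {F} {s} (_ , fs′ , fills) fs complete = subst (∣ ∁ F ∣ ≤_) (length-map proj₂ s)
    (∣p∣≤length (∁ F) (map proj₂ s) λ u∈∁F →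
      fromInj₂ (λ u∈F → contradiction u∈F (x∈∁p⇒x∉p u∈∁F)) (complete-maximal fs complete fs′ (fills _)))

  -- For list positions p < q, force q happened first, so its forcer already had
  -- all neighbours filled while the vertex forced at p was still unfilled.
  forcingSeq⇒upperTriangle : ∀ {F s} → ForcingSeq G F s →
    IsUpperTriangle (Adj G) (proj₁ ∘ lookup s) (proj₂ ∘ lookup s)
  forcingSeq⇒upperTriangle [] = record { diagonal = λ () ; below-diagonal = λ { {()} } }
  forcingSeq⇒upperTriangle (_∷_ {s} (v , u) (_ , u-unfilled , vu , _) fs) =
    record { diagonal = diag ; below-diagonal = below }
    where
    tri = forcingSeq⇒upperTriangle fs
    diag : ∀ p → Adj G (proj₁ (lookup ((v , u) ∷ s) p)) (proj₂ (lookup ((v , u) ∷ s) p)) ≡ true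
    diag zero    = vu
    diag (suc p) = diagonal tri p
    below : ∀ {p q} → p < q → Adj G (proj₁ (lookup ((v , u) ∷ s) q)) (proj₂ (lookup ((v , u) ∷ s) p)) ≡ false
    below {zero}  {suc q} _         =
      ¬-not λ adj → u-unfilled (neighbours-filled fs (∈-map⁺ proj₁ (∈-lookup q)) adj)
    below {suc p} {suc q} (s<s p<q) = below-diagonal tri p<q

  diagonalForces : ∀ {t} → (Fin t → Fin N) → (Fin t → Fin N) → List (Force G)
  diagonalForces u v = tabulate (λ p → u p , v p)

  module _ {t} {u v : Fin t → Fin N} where

    ∈-forcers⁻ : ∀ {w} → w ∈ₗ map proj₁ (diagonalForces u v) → ∃ λ q → w ≡ u q
    ∈-forcers⁻ = ∈-tabulate⁻ ∘ subst (_ ∈ₗ_) (map-tabulate _ proj₁)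

    ∈-forced⁻ : ∀ {w} → w ∈ₗ map proj₂ (diagonalForces u v) → ∃ λ q → w ≡ v q
    ∈-forced⁻ = ∈-tabulate⁻ ∘ subst (_ ∈ₗ_) (map-tabulate _ proj₂)

    ∈-forced⁺ : ∀ q → v q ∈ₗ map proj₂ (diagonalForces u v)
    ∈-forced⁺ q = subst (_ ∈ₗ_) (sym (map-tabulate _ proj₂)) (∈-tabulate⁺ q)

  upperTriangle⇒forcingSeq : ∀ {t F} {u v : Fin t → Fin N} → IsUpperTriangle (Adj G) u v →
    (∀ p → u p ∈ F) → (∀ p → v p ∉ F) → (∀ p {w} → Adj G (u p) w ≡ true → w ∉ F → ∃ λ q → w ≡ v q) →
    ForcingSeq G F (diagonalForces u v)
  upperTriangle⇒forcingSeq {ℕ.zero} _ _ _ _ = []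
  upperTriangle⇒forcingSeq {ℕ.suc t} {F} {u} {v} tri u∈F v∉F nbr =
    _∷_ (u zero , v zero) (inj₁ (u∈F zero) , v₀-unfilled , diagonal tri zero , onlyUnfilled , u₀-fresh)
      (upperTriangle⇒forcingSeq (IsUpperTriangle-tail tri) (u∈F ∘ suc) (v∉F ∘ suc) nbr′)
    where
    s = diagonalForces (u ∘ suc) (v ∘ suc)
    nbr′ : ∀ p {w} → Adj G (u (suc p)) w ≡ true → w ∉ F → ∃ λ q → w ≡ v (suc q)
    nbr′ p adj w∉F with nbr (suc p) adj w∉F
    ... | zero  , refl = contradiction (trans (sym adj) (below-diagonal tri z<s)) λ ()
    ... | suc q , w≡v = q , w≡v
    v₀-unfilled : ¬ Filled G F s (v zero)
    v₀-unfilled (inj₁ v₀∈F) = v∉F zero v₀∈F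
    v₀-unfilled (inj₂ v₀∈s) = contradiction (cols-injective tri (proj₂ (∈-forced⁻ v₀∈s))) λ ()
    onlyUnfilled : ∀ w → Adj G (u zero) w ≡ true → ¬ Filled G F s w → w ≡ v zero
    onlyUnfilled w adj w-unfilled with nbr zero adj (w-unfilled ∘ inj₁)
    ... | zero  , w≡v₀ = w≡v₀
    ... | suc q , refl = contradiction (inj₂ (∈-forced⁺ q)) w-unfilled
    u₀-fresh : u zero ∉ₗ map proj₁ s
    u₀-fresh u₀∈s = contradiction (rows-injective tri (proj₂ (∈-forcers⁻ u₀∈s))) λ ()

module _ {m n} {Y : Pattern m n} {G : SimpleGraph (m + n)} (part : PartitionAccordingTo Y G) where
  open ZeroForcing G

  row : Fin m → Fin (m + n)
  row i = i ↑ˡ n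

  col : Fin n → Fin (m + n)
  col j = m ↑ʳ j

  row≢col : ∀ i j → row i ≢ col j
  row≢col i j row≡col with trans (sym (splitAt-↑ˡ m i n)) (trans (cong (splitAt m) row≡col) (splitAt-↑ʳ m n j))
  ... | ()

  forcingSet⇒upperTriangle : ∀ {F} → ForcesFromV₁toV₂ m n G F → ∃ λ t → HasUpperTriangle Y t × ∣ ∁ F ∣ ≤ t
  forcingSet⇒upperTriangle (zfs , _ , s , fs , complete , V₁→V₂) =
    length s , (a , b , IsUpperTriangle-resp Adj≡Y (forcingSeq⇒upperTriangle fs)) , ∣∁F∣≤length zfs fs complete
    where
    ends : ∀ p → InV₁ {m} {n} (proj₁ (lookup s p)) × InV₂ {m} {n} (proj₂ (lookup s p))
    ends p = All.lookup V₁→V₂ (∈-lookup p)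
    a : Fin (length s) → Fin m
    a p = proj₁ (proj₁ (ends p))
    b : Fin (length s) → Fin n
    b p = proj₁ (proj₂ (ends p))
    Adj≡Y : ∀ p q → Adj G (proj₁ (lookup s q)) (proj₂ (lookup s p)) ≡ Y (a q) (b p)
    Adj≡Y p q = trans (cong₂ (Adj G) (proj₂ (proj₁ (ends q))) (proj₂ (proj₂ (ends p)))) (part (a q) (b p))

  upperTriangle⇒forcingSet : ∀ {t} → HasUpperTriangle Y t → ∃ λ F → ForcesFromV₁toV₂ m n G F × t ≤ ∣ ∁ F ∣
  upperTriangle⇒forcingSet {t} (a , b , tri) = F , ((s , fs , fills) , row∈F , s , fs , complete , V₁→V₂) , t≤∣∁F∣
    where
    isCol? : ∀ w → Dec (∃ λ q → w ≡ col (b q))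
    isCol? w = any? λ q → w ≟ col (b q)
    F = ∁ (select isCol?)
    row∈F : ∀ i → row i ∈ F
    row∈F i = x∉p⇒x∈∁p λ row∈cols → row≢col i _ (proj₂ (∈-select⁻ isCol? row∈cols))
    col∉F : ∀ q → col (b q) ∉ F
    col∉F q = x∈p⇒x∉∁p (∈-select⁺ isCol? (q , refl))
    outside-F⇒col : ∀ {w} → w ∉ F → ∃ λ q → w ≡ col (b q)
    outside-F⇒col w∉F = ∈-select⁻ isCol? (x∉∁p⇒x∈p w∉F)
    s = diagonalForces (row ∘ a) (col ∘ b)
    fs = upperTriangle⇒forcingSeq (IsUpperTriangle-resp (λ p q → sym (part (a q) (b p))) tri)
      (row∈F ∘ a) col∉F (λ _ _ → outside-F⇒col)
    fills : ∀ w → Filled G F s w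
    fills w with w ∈? F
    ... | yes w∈F = inj₁ w∈F
    ... | no w∉F with outside-F⇒col w∉F
    ...   | q , refl = inj₂ (∈-forced⁺ q)
    complete : Complete G F s
    complete (_ , _ , unfilled , _) = unfilled (fills _)
    V₁→V₂ : All (λ f → InV₁ {m} {n} (proj₁ f) × InV₂ {m} {n} (proj₂ f)) s
    V₁→V₂ = tabulate⁺ λ p → (a p , refl) , (b p , refl)
    t≤∣∁F∣ : t ≤ ∣ ∁ F ∣
    t≤∣∁F∣ = subst (_≤ ∣ ∁ F ∣) (length-tabulate _) (length≤∣∁F∣ fs)

theorem3p5 : (m n : ℕ) (Y : Pattern m n) (G : SimpleGraph (m + n)) →
    PartitionAccordingTo Y G →
    (t k : ℕ) → IsTri Y t → IsMinV₁V₂ForcingSize m n G k →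
    t ≡ (m + n) ∸ k
theorem3p5 m n Y G part t k (hasTri , maximal) ((F₀ , F₀-forces , ∣F₀∣≡k) , minimal)
  with upperTriangle⇒forcingSet part (triangle⇒upperTriangle hasTri) | forcingSet⇒upperTriangle part F₀-forces
... | F , F-forces , t≤∣∁F∣ | t₀ , tri₀ , ∣∁F₀∣≤t₀ = ≤-antisym
  (begin
    t                 ≤⟨ t≤∣∁F∣ ⟩
    ∣ ∁ F ∣           ≡⟨ ∣∁p∣≡n∸∣p∣ F ⟩
    m + n ∸ ∣ F ∣     ≤⟨ ∸-monoʳ-≤ (m + n) (minimal F F-forces) ⟩
    m + n ∸ k         ∎)
  (begin
    m + n ∸ k         ≡⟨ cong (m + n ∸_) ∣F₀∣≡k ⟨
    m + n ∸ ∣ F₀ ∣    ≡⟨ ∣∁p∣≡n∸∣p∣ F₀ ⟨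
    ∣ ∁ F₀ ∣          ≤⟨ ∣∁F₀∣≤t₀ ⟩
    t₀                ≤⟨ maximal t₀ (upperTriangle⇒triangle tri₀) ⟩
    t                 ∎)
  where open ≤-Reasoning
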